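{- Let $G$ be a planar graph with at least one vertex and girth at least $6$. Then $G$ contains at least one of the following configurations: (C2.1) a vertex $x$ of degree at most $1$; (C2.2) a vertex $x$ of degree $2$ adjacent to a vertex $y$ of degree at most $4$; (C2.3) a vertex $x$ of degree $5$ adjacent to five vertices of degree $2$.
   Context: The girth of a graph is the length of a shortest cycle (infinite for forests). -}

module Defs where

open import Data.Nat using (ℕ; zero; suc; _+_; _*_; _≤_; _≤ᵇ_)
open import Data.Fin using (Fin; toℕ; fromℕ; inject₁) renaming (zero to fzero; suc to fsuc)
import Data.Fin as F
open import Data.Bool using (Bool; true; false; _∧_; _∨_; if_then_else_)
open import Data.List using (List; map)
open import Data.Nat.ListAction using (sum)
open import Data.Bool.ListAction using (and; or)
open import Data.List.Base using (allFin)
open import Data.Product using (Σ; ∃; _×_; _,_)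
open import Relation.Nullary.Decidable using (⌊_⌋)
open import Relation.Binary.PropositionalEquality using (_≡_)
open import Function.Definitions using (Injective)

record SimpleGraph (n : ℕ) : Set where
  field
    adj    : Fin n → Fin n → Bool
    sym    : ∀ u v → adj u v ≡ adj v u
    irrefl : ∀ v → adj v v ≡ false

open SimpleGraph public

count : (k : ℕ) → (Fin k → Bool) → ℕ
count k p = sum (map (λ i → if p i then 1 else 0) (allFin k))

allᵇ : (k : ℕ) → (Fin k → Bool) → Bool
allᵇ k p = and (map p (allFin k))

anyᵇ : (k : ℕ) → (Fin k → Bool) → Bool
anyᵇ k p = or (map p (allFin k))

_==_ : ∀ {k} → Fin k → Fin k → Bool
i == j = ⌊ i F.≟ j ⌋

degree : ∀ {n} → SimpleGraph n → Fin n → ℕ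
degree {n} G v = count n (λ u → adj G v u)

Adjacent : ∀ {n} → SimpleGraph n → Fin n → Fin n → Set
Adjacent G u v = adj G u v ≡ true

-- A cycle of length (suc m) (m ≥ 2, i.e. length ≥ 3): distinct vertices
-- c 0, …, c m with c i ~ c (i+1) and c m ~ c 0.
record Cycle {n} (G : SimpleGraph n) (m : ℕ) : Set where
  field
    len≥3   : 2 ≤ m
    vert    : Fin (suc m) → Fin n
    vert-inj : Injective _≡_ _≡_ vert
    step    : ∀ (i : Fin m) → Adjacent G (vert (inject₁ i)) (vert (fsuc i))
    close   : Adjacent G (vert (fromℕ m)) (vert fzero)

-- girth G ≥ g  :⇔  every cycle has length ≥ g  (vacuous for forests,
-- whose girth is ∞)
GirthAtLeast : ∀ {n} → SimpleGraph n → ℕ → Set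
GirthAtLeast G g = ∀ m → Cycle G m → g ≤ suc m

iter : ∀ {A : Set} → ℕ → (A → A) → A → A
iter zero    f x = x
iter (suc j) f x = f (iter j f x)

-- number of orbits of a permutation f of Fin k: count the elements that
-- are the minimum of their orbit (orbits have size ≤ k)
orbits : (k : ℕ) → (Fin k → Fin k) → ℕ
orbits k f = count k (λ x → allᵇ k (λ j → toℕ x ≤ᵇ toℕ (iter (toℕ j) f x)))

reach : ∀ {k} → (Fin k → Fin k) → (Fin k → Fin k) → ℕ → Fin k → Fin k → Bool
reach f g zero    x y = x == y
reach {k} f g (suc t) x y =
  reach f g t x y ∨ anyᵇ k (λ z → reach f g t x z ∧ ((f z == y) ∨ (g z == y)))

components : (k : ℕ) → (Fin k → Fin k) → (Fin k → Fin k) → ℕ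
components k f g =
  count k (λ x → allᵇ k (λ y → if reach f g k x y then toℕ x ≤ᵇ toℕ y else true))

-- A combinatorial embedding (rotation system) of G: darts are the
-- ordered pairs (u , v) of adjacent vertices, rev reverses a dart,
-- rot cyclically permutes the darts with a common tail.
record RotationSystem {n} (G : SimpleGraph n) : Set where
  field
    darts     : ℕ
    tail head : Fin darts → Fin n
    dart-adj  : ∀ d → Adjacent G (tail d) (head d)
    dart-inj  : ∀ d d' → tail d ≡ tail d' → head d ≡ head d' → d ≡ d'
    dart-surj : ∀ u v → Adjacent G u v → ∃ λ d → tail d ≡ u × head d ≡ v
    rev       : Fin darts → Fin darts
    rev-tail  : ∀ d → tail (rev d) ≡ head d
    rev-head  : ∀ d → head (rev d) ≡ tail d
    rot       : Fin darts → Fin darts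
    rot-inj   : Injective _≡_ _≡_ rot
    rot-tail  : ∀ d → tail (rot d) ≡ tail d
    rot-cyclic : ∀ d d' → tail d ≡ tail d' → ∃ λ j → iter j rot d ≡ d'

  -- vertices (of positive degree), edges, faces, connected components
  V E F K : ℕ
  V = orbits darts rot
  E = orbits darts rev
  F = orbits darts (λ d → rot (rev d))
  K = components darts rot rev

-- G is planar iff it has a rotation system satisfying Euler's formula
-- V - E + F = 2·(#components) (i.e. every component has genus 0).
-- (Isolated vertices carry no darts and are trivially planar.)
Planar : ∀ {n} → SimpleGraph n → Set
Planar G = Σ (RotationSystem G) λ R →
  RotationSystem.V R + RotationSystem.F R ≡ RotationSystem.E R + 2 * RotationSystem.K R

-- Suppose none of the three configurations occurs; in particular every vertex has degree ≥ 2.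
-- Then a facial walk never backtracks, so girth ≥ 6 makes every face have length ≥ 6 and
-- 6F ≤ 2E. Give every vertex the charge 2·deg − 6 and let each vertex of degree ≥ 5 send 1 to
-- each neighbour of degree 2. A 2-vertex has only neighbours of degree ≥ 5 and ends at 0, a
-- 5-vertex has at most four 2-neighbours, and every other vertex stays non-negative, so
-- 6V ≤ 2·∑ deg = 4E. Hence 6(V + F) ≤ 6E, contradicting Euler's formula V + F = E + 2K, K ≥ 1.

module Submission where

open import Defs hiding (sym)
open import Data.Nat.Properties
open import Algebra.Properties.CommutativeMonoid.Sum +-0-commutativeMonoid
  using (sum; sum-syntax; sum-cong-≗; ∑-comm; ∑-distrib-+; ∑-permute)
open import Algebra.Properties.Semiring.Sum +-*-semiring using (*-distribˡ-sum)
open import Data.Bool using (Bool; true; false; _∧_; if_then_else_)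
import Data.Bool as Bool
open import Data.Bool.ListAction using (and)
open import Data.Bool.Properties using (T-≡; ∧-zeroʳ)
open import Data.Fin using (Fin; toℕ; fromℕ<) renaming (zero to fzero; suc to fsuc)
open import Data.Fin.Permutation using (permutation)
import Data.Fin.Properties as Fin
import Data.List as List using (tabulate)
open import Data.List.Properties using (map-tabulate)
open import Data.Nat using (ℕ; zero; suc; _+_; _*_; _∸_; _≤_; _<_; _≤ᵇ_; z≤n; s≤s; s≤s⁻¹; _%_; _/_; _≤?_; _≟_)
open import Data.Nat.DivMod using (m≡m%n+[m/n]*n; m%n<n)
import Data.Nat.ListAction as ListAction
open import Data.Product using (∃; ∃₂; _×_; _,_; proj₁; proj₂)
open import Data.Sum using (_⊎_; inj₁; inj₂; [_,_]′)
open import Function using (_∘_; id; Equivalence)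
open import Function.Definitions using (Injective)
open import Relation.Binary.Definitions using (tri<; tri≈; tri>)
open import Relation.Binary.PropositionalEquality
  using (_≡_; _≢_; refl; sym; trans; cong; cong₂; subst; subst₂; module ≡-Reasoning)
open import Relation.Nullary using (¬_; Dec; does; yes; no; contradiction)
open import Relation.Nullary.Decidable using (dec-true; dec-false; _×-dec_; _→-dec_)

𝟙 : Bool → ℕ
𝟙 b = if b then 1 else 0

𝟙≤1 : ∀ b → 𝟙 b ≤ 1
𝟙≤1 true  = s≤s z≤n
𝟙≤1 false = z≤n

count≡∑ : ∀ k (p : Fin k → Bool) → count k p ≡ ∑[ i < k ] 𝟙 (p i)
count≡∑ k p = trans (cong ListAction.sum (map-tabulate id (𝟙 ∘ p))) (sum-tabulate (𝟙 ∘ p))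
  where
  sum-tabulate : ∀ {k} (g : Fin k → ℕ) → ListAction.sum (List.tabulate g) ≡ sum g
  sum-tabulate {zero}  g = refl
  sum-tabulate {suc k} g = cong (g fzero +_) (sum-tabulate (g ∘ fsuc))

∑-const : ∀ k c → ∑[ i < k ] c ≡ k * c
∑-const zero    c = refl
∑-const (suc k) c = cong (c +_) (∑-const k c)

∑-zero : ∀ {k} {f : Fin k → ℕ} → (∀ i → f i ≡ 0) → sum f ≡ 0
∑-zero {k} f≡0 = trans (sum-cong-≗ f≡0) (trans (∑-const k 0) (*-zeroʳ k))

∑-mono-≤ : ∀ {k} {f g : Fin k → ℕ} → (∀ i → f i ≤ g i) → sum f ≤ sum g
∑-mono-≤ {zero}  f≤g = z≤n
∑-mono-≤ {suc k} f≤g = +-mono-≤ (f≤g fzero) (∑-mono-≤ (f≤g ∘ fsuc))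

∑-mono-< : ∀ {k} {f g : Fin k → ℕ} → (∀ i → f i ≤ g i) → ∀ i → f i < g i → sum f < sum g
∑-mono-< f≤g fzero    f<g = +-mono-<-≤ f<g (∑-mono-≤ (f≤g ∘ fsuc))
∑-mono-< f≤g (fsuc i) f<g = +-mono-≤-< (f≤g fzero) (∑-mono-< (f≤g ∘ fsuc) i f<g)

term≤∑ : ∀ {k} (f : Fin k → ℕ) i → f i ≤ sum f
term≤∑ f fzero    = m≤m+n _ _
term≤∑ f (fsuc i) = ≤-trans (term≤∑ (f ∘ fsuc) i) (m≤n+m _ _)

∑-positive : ∀ {k} (f : Fin k → ℕ) → 1 ≤ sum f → ∃ λ i → 1 ≤ f i
∑-positive {suc k} f 1≤∑ with f fzero in eq
... | zero  = let i , 1≤fi = ∑-positive (f ∘ fsuc) 1≤∑ in fsuc i , 1≤fi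
... | suc _ = fzero , subst (1 ≤_) (sym eq) (s≤s z≤n)

∑-atMostOne : ∀ {k} (f : Fin k → ℕ) → (∀ i → f i ≤ 1) →
              (∀ i j → 1 ≤ f i → 1 ≤ f j → i ≡ j) → sum f ≤ 1
∑-atMostOne {zero}  f f≤1 unique = z≤n
∑-atMostOne {suc k} f f≤1 unique with f fzero in eq
... | zero  = ∑-atMostOne (f ∘ fsuc) (f≤1 ∘ fsuc)
                (λ i j p q → Fin.suc-injective (unique (fsuc i) (fsuc j) p q))
... | suc n = begin
  suc n + sum (f ∘ fsuc) ≡⟨ cong (suc n +_) (∑-zero rest) ⟩
  suc n + 0              ≡⟨ +-identityʳ (suc n) ⟩
  suc n                  ≡⟨ eq ⟨
  f fzero                ≤⟨ f≤1 fzero ⟩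
  1                      ∎
  where
  open ≤-Reasoning
  rest : ∀ i → f (fsuc i) ≡ 0
  rest i = n<1⇒n≡0 (≰⇒> λ 1≤fi → Fin.0≢1+n (unique fzero (fsuc i) (subst (1 ≤_) (sym eq) (s≤s z≤n)) 1≤fi))

==-refl : ∀ {k} (a : Fin k) → (a == a) ≡ true
==-refl a with a Fin.≟ a
... | yes _  = refl
... | no a≢a = contradiction refl a≢a

==⇒≡ : ∀ {k} {i j : Fin k} → (i == j) ≡ true → i ≡ j
==⇒≡ {i = i} {j} i==j with i Fin.≟ j
... | yes i≡j = i≡j

fsuc==fsuc : ∀ {k} (i j : Fin k) → (fsuc i == fsuc j) ≡ (i == j)
fsuc==fsuc i j with i Fin.≟ j
... | yes _ = refl
... | no _  = refl

∑-pick : ∀ {k} (a : Fin k) (g : Fin k → ℕ) → ∑[ i < k ] (𝟙 (i == a) * g i) ≡ g a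
∑-pick {suc k} fzero    g =
  trans (cong₂ _+_ (+-identityʳ (g fzero)) (∑-zero {f = λ i → 𝟙 (fsuc i == fzero) * g (fsuc i)} λ _ → refl))
        (+-identityʳ (g fzero))
∑-pick {suc k} (fsuc a) g =
  trans (sum-cong-≗ (λ i → cong (λ b → 𝟙 b * g (fsuc i)) (fsuc==fsuc i a))) (∑-pick a (g ∘ fsuc))

∑-indicator : ∀ {k} (a : Fin k) → ∑[ i < k ] 𝟙 (i == a) ≡ 1
∑-indicator a = trans (sum-cong-≗ (λ i → sym (*-identityʳ (𝟙 (i == a))))) (∑-pick a (λ _ → 1))

1≤𝟙*𝟙 : ∀ {b c} → 1 ≤ 𝟙 b * 𝟙 c → b ≡ true × c ≡ true
1≤𝟙*𝟙 {true} {true} _ = refl , refl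

𝟙*𝟙≤1 : ∀ b c → 𝟙 b * 𝟙 c ≤ 1
𝟙*𝟙≤1 true  c = subst (_≤ 1) (sym (+-identityʳ (𝟙 c))) (𝟙≤1 c)
𝟙*𝟙≤1 false c = z≤n

∑∑-injective : ∀ {a b k} (P : Fin a → Fin b → Bool) (g : Fin a → Fin b → Fin k) →
               (∀ {x i y j} → P x i ≡ true → P y j ≡ true → g x i ≡ g y j → x ≡ y × i ≡ j) →
               ∑[ x < a ] ∑[ i < b ] 𝟙 (P x i) ≤ k
∑∑-injective {a} {b} {k} P g inj = begin
  ∑[ x < a ] ∑[ i < b ] 𝟙 (P x i)             ≡⟨ sum-cong-≗ (λ x → sum-cong-≗ (λ i → ∑-pick (g x i) _)) ⟨
  ∑[ x < a ] ∑[ i < b ] ∑[ z < k ] hit x i z  ≡⟨ sum-cong-≗ (λ x → ∑-comm (hit x)) ⟩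
  ∑[ x < a ] ∑[ z < k ] ∑[ i < b ] hit x i z  ≡⟨ ∑-comm (λ x z → ∑[ i < b ] hit x i z) ⟩
  ∑[ z < k ] ∑[ x < a ] ∑[ i < b ] hit x i z  ≤⟨ ∑-mono-≤ hit-once ⟩
  ∑[ z < k ] 1                                ≡⟨ trans (∑-const k 1) (*-identityʳ k) ⟩
  k                                           ∎
  where
  open ≤-Reasoning
  hit : Fin a → Fin b → Fin k → ℕ
  hit x i z = 𝟙 (z == g x i) * 𝟙 (P x i)

  hit-inv : ∀ x i z → 1 ≤ hit x i z → P x i ≡ true × z ≡ g x i
  hit-inv x i z h = let z==g , Pxi = 1≤𝟙*𝟙 {z == g x i} {P x i} h in Pxi , ==⇒≡ z==g

  hit-once : ∀ z → ∑[ x < a ] ∑[ i < b ] hit x i z ≤ 1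
  hit-once z = ∑-atMostOne (λ x → ∑[ i < b ] hit x i z) row≤1 λ x y hx hy →
    let i , hxi = ∑-positive (λ i → hit x i z) hx ; j , hyj = ∑-positive (λ j → hit y j z) hy
        Pxi , z≡gxi = hit-inv x i z hxi ; Pyj , z≡gyj = hit-inv y j z hyj
    in proj₁ (inj Pxi Pyj (trans (sym z≡gxi) z≡gyj))
    where
    row≤1 : ∀ x → ∑[ i < b ] hit x i z ≤ 1
    row≤1 x = ∑-atMostOne (λ i → hit x i z) (λ i → 𝟙*𝟙≤1 (z == g x i) (P x i)) λ i j hi hj →
      let Pxi , z≡gxi = hit-inv x i z hi ; Pxj , z≡gxj = hit-inv x j z hj
      in proj₂ (inj Pxi Pxj (trans (sym z≡gxi) z≡gxj))

∑-injective : ∀ {a k} (P : Fin a → Bool) (g : Fin a → Fin k) →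
              (∀ {x y} → P x ≡ true → P y ≡ true → g x ≡ g y → x ≡ y) →
              ∑[ x < a ] 𝟙 (P x) ≤ k
∑-injective P g inj =
  subst (_≤ _) (sum-cong-≗ (λ x → +-identityʳ (𝟙 (P x))))
    (∑∑-injective {b = 1} (λ x _ → P x) (λ x _ → g x) λ { {i = fzero} {j = fzero} p q e → inj p q e , refl })

∑∑-covered : ∀ {a b k} (P : Fin a → Fin b → Bool) (s : Fin k → Fin a) (t : Fin k → Fin b) →
             (∀ x y → P x y ≡ true → ∃ λ d → s d ≡ x × t d ≡ y) →
             ∑[ x < a ] ∑[ y < b ] 𝟙 (P x y) ≤ k
∑∑-covered {a} {b} {k} P s t covered = begin
  ∑[ x < a ] ∑[ y < b ] 𝟙 (P x y)             ≤⟨ ∑-mono-≤ (λ x → ∑-mono-≤ (λ y → P≤hits x y (P x y) refl)) ⟩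
  ∑[ x < a ] ∑[ y < b ] ∑[ d < k ] at d x y  ≡⟨ sum-cong-≗ (λ x → ∑-comm (λ y d → at d x y)) ⟩
  ∑[ x < a ] ∑[ d < k ] ∑[ y < b ] at d x y  ≡⟨ ∑-comm (λ x d → ∑[ y < b ] at d x y) ⟩
  ∑[ d < k ] ∑[ x < a ] ∑[ y < b ] at d x y  ≡⟨ sum-cong-≗ at-once ⟩
  ∑[ d < k ] 1                                ≡⟨ trans (∑-const k 1) (*-identityʳ k) ⟩
  k                                           ∎
  where
  open ≤-Reasoning
  at : Fin k → Fin a → Fin b → ℕ
  at d x y = 𝟙 (x == s d) * 𝟙 (y == t d)

  P≤hits : ∀ x y b → P x y ≡ b → 𝟙 b ≤ ∑[ d < k ] at d x y
  P≤hits x y false _   = z≤n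
  P≤hits x y true  Pxy with covered x y Pxy
  ... | d , refl , refl = subst (_≤ ∑[ d′ < k ] at d′ x y) (cong₂ (λ p q → 𝟙 p * 𝟙 q) (==-refl x) (==-refl y))
                            (term≤∑ (λ d′ → at d′ x y) d)

  at-once : ∀ d → ∑[ x < a ] ∑[ y < b ] at d x y ≡ 1
  at-once d = begin-equality
    ∑[ x < a ] ∑[ y < b ] at d x y
      ≡⟨ sum-cong-≗ (λ x → *-distribˡ-sum (𝟙 (x == s d)) (λ y → 𝟙 (y == t d))) ⟨
    ∑[ x < a ] (𝟙 (x == s d) * ∑[ y < b ] 𝟙 (y == t d))
      ≡⟨ sum-cong-≗ (λ x → cong (𝟙 (x == s d) *_) (∑-indicator (t d))) ⟩
    ∑[ x < a ] (𝟙 (x == s d) * 1)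
      ≡⟨ ∑-pick (s d) (λ _ → 1) ⟩
    1 ∎

∧-true : ∀ {a b} → a ∧ b ≡ true → a ≡ true × b ≡ true
∧-true {true} b≡true = refl , b≡true

allᵇ-elim : ∀ {k} {p : Fin k → Bool} → allᵇ k p ≡ true → ∀ j → p j ≡ true
allᵇ-elim {k} {p} all≡true = and-tabulate p (trans (sym (cong and (map-tabulate id p))) all≡true)
  where
  and-tabulate : ∀ {k} (q : Fin k → Bool) → and (List.tabulate q) ≡ true → ∀ j → q j ≡ true
  and-tabulate q h fzero    = proj₁ (∧-true h)
  and-tabulate q h (fsuc j) = and-tabulate (q ∘ fsuc) (proj₂ (∧-true h)) j

allᵇ-intro : ∀ {k} {p : Fin k → Bool} → (∀ j → p j ≡ true) → allᵇ k p ≡ true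
allᵇ-intro {k} {p} all-true = trans (cong and (map-tabulate id p)) (and-tabulate p all-true)
  where
  and-tabulate : ∀ {k} (q : Fin k → Bool) → (∀ j → q j ≡ true) → and (List.tabulate q) ≡ true
  and-tabulate {zero}  q h = refl
  and-tabulate {suc k} q h = cong₂ _∧_ (h fzero) (and-tabulate (q ∘ fsuc) (h ∘ fsuc))

iter-+ : ∀ {A : Set} a b (f : A → A) x → iter (a + b) f x ≡ iter a f (iter b f x)
iter-+ zero    b f x = refl
iter-+ (suc a) b f x = cong f (iter-+ a b f x)

iter-injective : ∀ {A : Set} {f : A → A} → Injective _≡_ _≡_ f → ∀ a → Injective _≡_ _≡_ (iter a f)
iter-injective f-inj zero    e = e
iter-injective f-inj (suc a) e = iter-injective f-inj a (f-inj e)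

iter-fixed : ∀ {A : Set} {f : A → A} {x} → f x ≡ x → ∀ j → iter j f x ≡ x
iter-fixed fx≡x zero    = refl
iter-fixed {f = f} fx≡x (suc j) = trans (cong f (iter-fixed fx≡x j)) fx≡x

iter-periodic : ∀ {A : Set} {f : A → A} {x} p → iter p f x ≡ x → ∀ q → iter (q * p) f x ≡ x
iter-periodic         p per zero    = refl
iter-periodic {f = f} p per (suc q) = trans (iter-+ p (q * p) f _) (trans (cong (iter p f) (iter-periodic p per q)) per)

module Orbits {k} (f : Fin k → Fin k) where

  isOrbitMin : Fin k → Bool
  isOrbitMin x = allᵇ k (λ j → toℕ x ≤ᵇ toℕ (iter (toℕ j) f x))

  orbits≡∑ : orbits k f ≡ ∑[ x < k ] 𝟙 (isOrbitMin x)
  orbits≡∑ = count≡∑ k isOrbitMin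

  isOrbitMin-intro : ∀ {x} → (∀ i → toℕ x ≤ toℕ (iter i f x)) → isOrbitMin x ≡ true
  isOrbitMin-intro x≤ = allᵇ-intro {k} (λ j → T-≡ .Equivalence.to (≤⇒≤ᵇ (x≤ (toℕ j))))

  isOrbitMin-elim : ∀ {x} → isOrbitMin x ≡ true → ∀ i → i < k → toℕ x ≤ toℕ (iter i f x)
  isOrbitMin-elim {x} min i i<k =
    subst (λ j → toℕ x ≤ toℕ (iter j f x)) (Fin.toℕ-fromℕ< i<k)
      (≤ᵇ⇒≤ _ _ (T-≡ .Equivalence.from (allᵇ-elim min (fromℕ< i<k))))

  orbits-involution : (∀ x → f (f x) ≡ x) → k ≤ 2 * orbits k f
  orbits-involution inv = begin
    k                                                    ≡⟨ trans (∑-const k 1) (*-identityʳ k) ⟨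
    ∑[ x < k ] 1                                         ≤⟨ ∑-mono-≤ some-endpoint-min ⟩
    ∑[ x < k ] (𝟙 (isOrbitMin x) + 𝟙 (isOrbitMin (f x))) ≡⟨ ∑-distrib-+ (𝟙 ∘ isOrbitMin) (𝟙 ∘ isOrbitMin ∘ f) ⟩
    ∑[ x < k ] 𝟙 (isOrbitMin x) + ∑[ x < k ] 𝟙 (isOrbitMin (f x))
      ≡⟨ cong (∑[ x < k ] 𝟙 (isOrbitMin x) +_) (∑-permute (𝟙 ∘ isOrbitMin) (permutation f f inv inv)) ⟨
    ∑[ x < k ] 𝟙 (isOrbitMin x) + ∑[ x < k ] 𝟙 (isOrbitMin x)
      ≡⟨ cong₂ _+_ orbits≡∑ (trans (*-identityˡ (orbits k f)) orbits≡∑) ⟨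
    2 * orbits k f                                       ∎
    where
    open ≤-Reasoning
    orbit-pair : ∀ x i → iter i f x ≡ x ⊎ iter i f x ≡ f x
    orbit-pair x zero = inj₁ refl
    orbit-pair x (suc i) with orbit-pair x i
    ... | inj₁ e = inj₂ (cong f e)
    ... | inj₂ e = inj₁ (trans (cong f e) (inv x))

    smaller-end-min : ∀ {x} → toℕ x ≤ toℕ (f x) → isOrbitMin x ≡ true
    smaller-end-min {x} x≤fx = isOrbitMin-intro {x} λ i →
      [ (λ e → ≤-reflexive (cong toℕ (sym e))) , (λ e → subst (λ y → toℕ x ≤ toℕ y) (sym e) x≤fx) ]′ (orbit-pair x i)

    some-endpoint-min : ∀ x → 1 ≤ 𝟙 (isOrbitMin x) + 𝟙 (isOrbitMin (f x))
    some-endpoint-min x with ≤-total (toℕ x) (toℕ (f x))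
    ... | inj₁ x≤fx = subst (λ b → 1 ≤ 𝟙 b + 𝟙 (isOrbitMin (f x))) (sym (smaller-end-min x≤fx)) (s≤s z≤n)
    ... | inj₂ fx≤x = subst (λ b → 1 ≤ 𝟙 (isOrbitMin x) + 𝟙 b)
                        (sym (smaller-end-min (subst (λ y → toℕ (f x) ≤ toℕ y) (sym (inv x)) fx≤x)))
                        (m≤n+m 1 (𝟙 (isOrbitMin x)))

  module _ (f-injective : Injective _≡_ _≡_ f) where

    period : ∀ x → ∃ λ p → suc p ≤ k × iter (suc p) f x ≡ x
    period x with Fin.pigeonhole (n<1+n k) (λ i → iter (toℕ i) f x)
    ... | i , j , i<j , fⁱx≡fʲx with m≤n⇒∃[o]m+o≡n i<j
    ... | p , i+1+p≡j =
      p , ≤-trans (s≤s (m≤n+m p (toℕ i))) (≤-trans (≤-reflexive i+1+p≡j) (Fin.toℕ≤pred[n] j)) ,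
      sym (iter-injective f-injective (toℕ i) (begin
        iter (toℕ i) f x                    ≡⟨ fⁱx≡fʲx ⟩
        iter (toℕ j) f x                    ≡⟨ cong (λ n → iter n f x) (trans (sym i+1+p≡j) (sym (+-suc (toℕ i) p))) ⟩
        iter (toℕ i + suc p) f x            ≡⟨ iter-+ (toℕ i) (suc p) f x ⟩
        iter (toℕ i) f (iter (suc p) f x)   ∎))
      where open ≡-Reasoning

    isOrbitMin-≤ : ∀ {x} → isOrbitMin x ≡ true → ∀ i → toℕ x ≤ toℕ (iter i f x)
    isOrbitMin-≤ {x} min i with period x
    ... | p , p<k , per =
      subst (λ y → toℕ x ≤ toℕ y) (sym fⁱx≡fʳx) (isOrbitMin-elim min r (<-≤-trans (m%n<n i (suc p)) p<k))
      where
      r : ℕ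
      r = i % suc p
      fⁱx≡fʳx : iter i f x ≡ iter r f x
      fⁱx≡fʳx = begin
        iter i f x                                ≡⟨ cong (λ n → iter n f x) (m≡m%n+[m/n]*n i (suc p)) ⟩
        iter (r + i / suc p * suc p) f x          ≡⟨ iter-+ r _ f x ⟩
        iter r f (iter (i / suc p * suc p) f x)   ≡⟨ cong (iter r f) (iter-periodic (suc p) per (i / suc p)) ⟩
        iter r f x                                ∎
        where open ≡-Reasoning

    isOrbitMin-unique : ∀ {x y} → isOrbitMin x ≡ true → isOrbitMin y ≡ true → ∀ i → iter i f x ≡ y → x ≡ y
    isOrbitMin-unique {x} {y} minx miny i fⁱx≡y with period x
    ... | p , _ , per = Fin.toℕ-injective (≤-antisym
      (subst (λ z → toℕ x ≤ toℕ z) fⁱx≡y (isOrbitMin-≤ minx i))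
      (subst (λ z → toℕ y ≤ toℕ z) y-returns-to-x (isOrbitMin-≤ miny (i * p))))
      where
      y-returns-to-x : iter (i * p) f y ≡ x
      y-returns-to-x = begin
        iter (i * p) f y                ≡⟨ cong (iter (i * p) f) fⁱx≡y ⟨
        iter (i * p) f (iter i f x)     ≡⟨ iter-+ (i * p) i f x ⟨
        iter (i * p + i) f x            ≡⟨ cong (λ n → iter n f x) (trans (+-comm (i * p) i) (sym (*-suc i p))) ⟩
        iter (i * suc p) f x            ≡⟨ iter-periodic (suc p) per i ⟩
        x                               ∎
        where open ≡-Reasoning

    module _ (m : ℕ) (aperiodic : ∀ x i → 1 ≤ i → i < m → iter i f x ≢ x) where

      private
        returns-only-at-0 : ∀ {x} d → d < m → iter d f x ≡ x → d ≡ 0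
        returns-only-at-0         zero    _   _   = refl
        returns-only-at-0 {x} (suc d) d<m ret = contradiction ret (aperiodic x (suc d) (s≤s z≤n) d<m)

        ordered-coordinates : ∀ {x y a b} → isOrbitMin x ≡ true → isOrbitMin y ≡ true → a ≤ b → b < m →
                              iter a f x ≡ iter b f y → x ≡ y × a ≡ b
        ordered-coordinates {x} {y} {a} {b} minx miny a≤b b<m fᵃx≡fᵇy = x≡y , a≡b
          where
          open ≡-Reasoning
          d = b ∸ a
          x≡fᵈy : x ≡ iter d f y
          x≡fᵈy = iter-injective f-injective a (begin
            iter a f x               ≡⟨ fᵃx≡fᵇy ⟩
            iter b f y               ≡⟨ cong (λ n → iter n f y) (m+[n∸m]≡n a≤b) ⟨
            iter (a + d) f y         ≡⟨ iter-+ a d f y ⟩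
            iter a f (iter d f y)    ∎)
          x≡y : x ≡ y
          x≡y = sym (isOrbitMin-unique miny minx d (sym x≡fᵈy))
          d≡0 : d ≡ 0
          d≡0 = returns-only-at-0 d (≤-<-trans (m∸n≤m b a) b<m) (sym (trans x≡fᵈy (cong (iter d f) (sym x≡y))))
          a≡b : a ≡ b
          a≡b = begin
            a              ≡⟨ +-identityʳ a ⟨
            a + 0          ≡⟨ cong (a +_) d≡0 ⟨
            a + (b ∸ a)    ≡⟨ m+[n∸m]≡n a≤b ⟩
            b              ∎

        orbit-coordinates : ∀ {x i y j} → isOrbitMin x ≡ true → isOrbitMin y ≡ true →
                            iter (toℕ {m} i) f x ≡ iter (toℕ j) f y → x ≡ y × i ≡ j
        orbit-coordinates {i = i} {j = j} minx miny e with ≤-total (toℕ i) (toℕ j)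
        ... | inj₁ i≤j = let x≡y , i≡j = ordered-coordinates minx miny i≤j (Fin.toℕ<n j) e
                         in x≡y , Fin.toℕ-injective i≡j
        ... | inj₂ j≤i = let y≡x , j≡i = ordered-coordinates miny minx j≤i (Fin.toℕ<n i) (sym e)
                         in sym y≡x , sym (Fin.toℕ-injective j≡i)

      -- Distinct pairs (orbit minimum x, j < m) give distinct points fʲ x.
      orbits-aperiodic : m * orbits k f ≤ k
      orbits-aperiodic = begin
        m * orbits k f                          ≡⟨ cong (m *_) orbits≡∑ ⟩
        m * ∑[ x < k ] 𝟙 (isOrbitMin x)         ≡⟨ *-distribˡ-sum m (𝟙 ∘ isOrbitMin) ⟩
        ∑[ x < k ] (m * 𝟙 (isOrbitMin x))       ≡⟨ sum-cong-≗ (λ x → ∑-const m (𝟙 (isOrbitMin x))) ⟨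
        ∑[ x < k ] ∑[ j < m ] 𝟙 (isOrbitMin x)  ≤⟨ ∑∑-injective (λ x _ → isOrbitMin x) (λ x j → iter (toℕ j) f x)
                                                                  orbit-coordinates ⟩
        k                                       ∎
        where open ≤-Reasoning

count-positive : ∀ k (p : Fin k → Bool) i → p i ≡ true → 1 ≤ count k p
count-positive k p i pi≡true =
  subst (1 ≤_) (sym (count≡∑ k p)) (≤-trans (≤-reflexive (cong 𝟙 (sym pi≡true))) (term≤∑ (𝟙 ∘ p) i))

1≤components : ∀ {k} (f g : Fin k → Fin k) → 1 ≤ k → 1 ≤ components k f g
1≤components {suc k} f g _ = count-positive (suc k) _ fzero (allᵇ-intro {suc k} (λ y → if-same (reach f g (suc k) fzero y)))
  where
  if-same : ∀ b → (if b then true else true) ≡ true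
  if-same true  = refl
  if-same false = refl

module _ {N} (G : SimpleGraph N) where

  Adjacent⇒≢ : ∀ {u v} → Adjacent G u v → u ≢ v
  Adjacent⇒≢ {u} u~v refl = contradiction (trans (sym u~v) (irrefl G u)) λ ()

  degree≡∑ : ∀ u → degree G u ≡ ∑[ v < N ] 𝟙 (adj G u v)
  degree≡∑ u = count≡∑ N (adj G u)

  degree≤1 : ∀ {u} v → (∀ w → Adjacent G u w → w ≡ v) → degree G u ≤ 1
  degree≤1 {u} v only-v = begin
    degree G u                 ≡⟨ degree≡∑ u ⟩
    ∑[ w < N ] 𝟙 (adj G u w)   ≤⟨ ∑-mono-≤ (λ w → adj≤is-v w (adj G u w) refl) ⟩
    ∑[ w < N ] 𝟙 (w == v)      ≡⟨ ∑-indicator v ⟩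
    1                          ∎
    where
    open ≤-Reasoning
    adj≤is-v : ∀ w b → adj G u w ≡ b → 𝟙 b ≤ 𝟙 (w == v)
    adj≤is-v w false _   = z≤n
    adj≤is-v w true  u~w = ≤-reflexive (cong 𝟙 (sym (subst (λ x → (w == x) ≡ true) (only-v w u~w) (==-refl w))))

record NonBacktrackingClosedWalk {N} (G : SimpleGraph N) (ℓ : ℕ) : Set where
  field
    pos             : ℕ → Fin N
    periodic        : ∀ t → pos (t + ℓ) ≡ pos t
    step            : ∀ t → Adjacent G (pos t) (pos (suc t))
    nonbacktracking : ∀ t → pos t ≢ pos (2 + t)

module _ {N} {G : SimpleGraph N} {ℓ} (W : NonBacktrackingClosedWalk G ℓ) where
  open NonBacktrackingClosedWalk W

  pos-apart : ∀ t d → 1 ≤ d → d ≤ 2 → pos t ≢ pos (d + t)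
  pos-apart t 1 _ _ = Adjacent⇒≢ G (step t)
  pos-apart t 2 _ _ = nonbacktracking t
  pos-apart t (suc (suc (suc _))) _ (s≤s (s≤s ()))

  -- Two positions of a closed walk of length ≤ 5 are at cyclic distance ≤ 2.
  pos-injective : ℓ ≤ 5 → ∀ {a b} → a < b → b < ℓ → pos a ≢ pos b
  pos-injective ℓ≤5 {a} {b} a<b b<ℓ with b ∸ a ≤? 2
  ... | yes d≤2 = subst (λ n → pos a ≢ pos n) b-a+a≡b (pos-apart a (b ∸ a) (m<n⇒0<n∸m a<b) d≤2)
    where
    b-a+a≡b : b ∸ a + a ≡ b
    b-a+a≡b = m∸n+n≡m (<⇒≤ a<b)
  ... | no  d≰2 = λ pa≡pb → pos-apart b e (m<n⇒0<n∸m d<ℓ) e≤2 (trans (sym pa≡pb) wrap)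
    where
    d e : ℕ
    d = b ∸ a
    e = ℓ ∸ d
    b-a+a≡b : d + a ≡ b
    b-a+a≡b = m∸n+n≡m (<⇒≤ a<b)
    d<ℓ : d < ℓ
    d<ℓ = ≤-<-trans (m∸n≤m b a) b<ℓ
    e≤2 : e ≤ 2
    e≤2 = ∸-mono ℓ≤5 (≰⇒> d≰2)
    wrap : pos a ≡ pos (e + b)
    wrap = sym (trans (cong pos (begin
      e + b              ≡⟨ cong (e +_) b-a+a≡b ⟨
      e + (d + a)        ≡⟨ +-assoc e d a ⟨
      (e + d) + a        ≡⟨ cong (_+ a) (m∸n+n≡m (<⇒≤ d<ℓ)) ⟩
      ℓ + a              ≡⟨ +-comm ℓ a ⟩
      a + ℓ              ∎)) (periodic a))
      where open ≡-Reasoning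

  closedWalk⇒Cycle : ∀ {m} → ℓ ≡ suc m → 2 ≤ m → m ≤ 4 → Cycle G m
  closedWalk⇒Cycle {m} refl 2≤m m≤4 = record
    { len≥3    = 2≤m
    ; vert     = vert
    ; vert-inj = vert-inj
    ; step     = λ i → subst (λ n → Adjacent G (pos n) (pos (suc (toℕ i)))) (sym (Fin.toℕ-inject₁ i)) (step (toℕ i))
    ; close    = subst₂ (λ x y → Adjacent G (pos x) y) (sym (Fin.toℕ-fromℕ m)) (periodic 0) (step m)
    }
    where
    vert : Fin (suc m) → Fin N
    vert i = pos (toℕ i)
    vert-inj : Injective _≡_ _≡_ vert
    vert-inj {i} {j} vi≡vj with <-cmp (toℕ i) (toℕ j)
    ... | tri< i<j _ _ = contradiction vi≡vj (pos-injective (s≤s m≤4) i<j (Fin.toℕ<n j))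
    ... | tri≈ _ i≡j _ = Fin.toℕ-injective i≡j
    ... | tri> _ _ j<i = contradiction (sym vi≡vj) (pos-injective (s≤s m≤4) j<i (Fin.toℕ<n i))

girth≥6⇒¬shortClosedWalk : ∀ {N} {G : SimpleGraph N} → GirthAtLeast G 6 →
                            ∀ {ℓ} → 1 ≤ ℓ → ℓ < 6 → ¬ NonBacktrackingClosedWalk G ℓ
girth≥6⇒¬shortClosedWalk {G = G} girth≥6 {1} _ _ W =
  Adjacent⇒≢ G (step 0) (sym (periodic 0))
  where open NonBacktrackingClosedWalk W
girth≥6⇒¬shortClosedWalk girth≥6 {2} _ _ W =
  nonbacktracking 0 (sym (periodic 0))
  where open NonBacktrackingClosedWalk W
girth≥6⇒¬shortClosedWalk girth≥6 {suc (suc (suc m))} _ ℓ<6 W =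
  <⇒≱ ℓ<6 (girth≥6 (2 + m) (closedWalk⇒Cycle W refl (s≤s (s≤s z≤n)) (s≤s⁻¹ (s≤s⁻¹ ℓ<6))))

LowVertex Light2Vertex Full5Vertex : ∀ {N} → SimpleGraph N → Set
LowVertex    G = ∃ λ x → degree G x ≤ 1
Light2Vertex G = ∃₂ λ x y → degree G x ≡ 2 × Adjacent G x y × degree G y ≤ 4
Full5Vertex  G = ∃ λ x → degree G x ≡ 5 × (∀ y → Adjacent G x y → degree G y ≡ 2)

module _ {N} (G : SimpleGraph N) where

  adjacent? : ∀ x y → Dec (Adjacent G x y)
  adjacent? x y = adj G x y Bool.≟ true

  lowVertex? : Dec (LowVertex G)
  lowVertex? = Fin.any? λ x → degree G x ≤? 1

  light2Vertex? : Dec (Light2Vertex G)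
  light2Vertex? = Fin.any? λ x → Fin.any? λ y →
    (degree G x ≟ 2) ×-dec adjacent? x y ×-dec (degree G y ≤? 4)

  full5Vertex? : Dec (Full5Vertex G)
  full5Vertex? = Fin.any? λ x →
    (degree G x ≟ 5) ×-dec Fin.all? (λ y → adjacent? x y →-dec (degree G y ≟ 2))

module Discharging {N} (G : SimpleGraph N)
  (¬low : ¬ LowVertex G) (¬light : ¬ Light2Vertex G) (¬full : ¬ Full5Vertex G) where

  δ≥2 : ∀ x → 2 ≤ degree G x
  δ≥2 x = ≰⇒> λ dx≤1 → ¬low (x , dx≤1)

  sends : Fin N → Fin N → Bool
  sends u v = adj G u v ∧ does (5 ≤? degree G u) ∧ does (degree G v ≟ 2)

  sent received : Fin N → ℕ
  sent     u = ∑[ v < N ] 𝟙 (sends u v)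
  received v = ∑[ u < N ] 𝟙 (sends u v)

  sent≤degree : ∀ u → sent u ≤ degree G u
  sent≤degree u = ≤-trans (∑-mono-≤ (λ v → 𝟙-∧≤ (adj G u v) _)) (≤-reflexive (sym (degree≡∑ G u)))
    where
    𝟙-∧≤ : ∀ a b → 𝟙 (a ∧ b) ≤ 𝟙 a
    𝟙-∧≤ true  b = 𝟙≤1 b
    𝟙-∧≤ false b = z≤n

  sent≡0 : ∀ u → degree G u < 5 → sent u ≡ 0
  sent≡0 u du<5 = ∑-zero λ v →
    cong 𝟙 (trans (cong (λ b → adj G u v ∧ b ∧ does (degree G v ≟ 2)) (dec-false (5 ≤? degree G u) (<⇒≱ du<5)))
                  (∧-zeroʳ (adj G u v)))

  sent<degree : ∀ u → degree G u ≡ 5 → sent u < degree G u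
  sent<degree u du≡5 = subst (sent u <_) (sym (degree≡∑ G u)) (∑-mono-< sent-term≤ y sent-term<)
    where
    non-2-neighbour : ∃ λ y → Adjacent G u y × degree G y ≢ 2
    non-2-neighbour
      with Fin.¬∀⟶∃¬ N _ (λ y → adjacent? G u y →-dec (degree G y ≟ 2)) (λ all-2 → ¬full (u , du≡5 , all-2))
    ... | y , ¬[u~y⇒dy≡2] with adjacent? G u y
    ... | yes u~y = y , u~y , λ dy≡2 → ¬[u~y⇒dy≡2] (λ _ → dy≡2)
    ... | no ¬u~y = contradiction (λ u~y → contradiction u~y ¬u~y) ¬[u~y⇒dy≡2]

    y : Fin N
    y = proj₁ non-2-neighbour

    sent-term≤ : ∀ v → 𝟙 (sends u v) ≤ 𝟙 (adj G u v)
    sent-term≤ v with adj G u v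
    ... | true  = 𝟙≤1 _
    ... | false = z≤n

    sent-term< : 𝟙 (sends u y) < 𝟙 (adj G u y)
    sent-term< = let _ , u~y , dy≢2 = non-2-neighbour in
      subst₂ (λ b c → 𝟙 b < 𝟙 c)
        (sym (trans (cong (λ b → adj G u y ∧ does (5 ≤? degree G u) ∧ b) (dec-false (degree G y ≟ 2) dy≢2))
                    (trans (cong (adj G u y ∧_) (∧-zeroʳ _)) (∧-zeroʳ (adj G u y)))))
        (sym u~y) (s≤s z≤n)

  received≡degree : ∀ v → degree G v ≡ 2 → received v ≡ degree G v
  received≡degree v dv≡2 = trans (sum-cong-≗ (λ u → cong 𝟙 (trans (sends-to-v u) (SimpleGraph.sym G u v))))
                                 (sym (degree≡∑ G v))
    where
    sends-to-v : ∀ u → sends u v ≡ adj G u v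
    sends-to-v u with adj G u v in u~v
    ... | false = refl
    ... | true  = cong₂ _∧_ (dec-true (5 ≤? degree G u) 5≤du) (dec-true (degree G v ≟ 2) dv≡2)
      where
      5≤du : 5 ≤ degree G u
      5≤du = ≰⇒> λ du≤4 → ¬light (v , u , dv≡2 , trans (SimpleGraph.sym G v u) u~v , du≤4)

  charge-balance : ∀ u → 6 + sent u ≤ 2 * degree G u + received u
  charge-balance u = balance (degree G u) refl
    where
    open ≤-Reasoning
    no-sent : ∀ {d} → degree G u ≡ d → d < 5 → 6 + sent u ≡ 6
    no-sent du≡d d<5 = cong (6 +_) (sent≡0 u (subst (_< 5) (sym du≡d) d<5))

    balance : ∀ d → degree G u ≡ d → 6 + sent u ≤ 2 * d + received u
    balance 0 du≡0 = contradiction (u , subst (_≤ 1) (sym du≡0) z≤n) ¬low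
    balance 1 du≡1 = contradiction (u , ≤-reflexive du≡1) ¬low
    balance 2 du≡2 = begin
      6 + sent u          ≡⟨ no-sent du≡2 (s≤s (s≤s (s≤s z≤n))) ⟩
      2 * 2 + 2           ≡⟨ cong (2 * 2 +_) (trans (received≡degree u du≡2) du≡2) ⟨
      2 * 2 + received u  ∎
    balance 3 du≡3 = begin
      6 + sent u          ≡⟨ no-sent du≡3 (s≤s (s≤s (s≤s (s≤s z≤n)))) ⟩
      2 * 3               ≤⟨ m≤m+n (2 * 3) (received u) ⟩
      2 * 3 + received u  ∎
    balance 4 du≡4 = begin
      6 + sent u          ≡⟨ no-sent du≡4 ≤-refl ⟩
      6                   ≤⟨ m≤n+m 6 2 ⟩
      2 * 4               ≤⟨ m≤m+n (2 * 4) (received u) ⟩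
      2 * 4 + received u  ∎
    balance 5 du≡5 = begin
      6 + sent u          ≤⟨ +-monoʳ-≤ 6 (s≤s⁻¹ (subst (sent u <_) du≡5 (sent<degree u du≡5))) ⟩
      2 * 5               ≤⟨ m≤m+n (2 * 5) (received u) ⟩
      2 * 5 + received u  ∎
    balance d@(suc (suc (suc (suc (suc (suc k)))))) du≡d = begin
      6 + sent u          ≤⟨ +-monoʳ-≤ 6 (subst (sent u ≤_) du≡d (sent≤degree u)) ⟩
      6 + d               ≤⟨ +-monoˡ-≤ d (m≤m+n 6 k) ⟩
      d + d               ≡⟨ cong (d +_) (+-identityʳ d) ⟨
      2 * d               ≤⟨ m≤m+n (2 * d) (received u) ⟩
      2 * d + received u  ∎

  6N≤2∑degree : 6 * N ≤ 2 * ∑[ u < N ] degree G u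
  6N≤2∑degree = +-cancelʳ-≤ (∑[ u < N ] sent u) (6 * N) (2 * ∑[ u < N ] degree G u) (begin
    6 * N + ∑[ u < N ] sent u
      ≡⟨ cong (_+ ∑[ u < N ] sent u) (trans (∑-const N 6) (*-comm N 6)) ⟨
    ∑[ u < N ] 6 + ∑[ u < N ] sent u
      ≡⟨ ∑-distrib-+ (λ _ → 6) sent ⟨
    ∑[ u < N ] (6 + sent u)
      ≤⟨ ∑-mono-≤ charge-balance ⟩
    ∑[ u < N ] (2 * degree G u + received u)
      ≡⟨ ∑-distrib-+ (λ u → 2 * degree G u) received ⟩
    ∑[ u < N ] (2 * degree G u) + ∑[ u < N ] received u
      ≡⟨ cong₂ _+_ (*-distribˡ-sum 2 (degree G)) (∑-comm (λ u v → 𝟙 (sends u v))) ⟨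
    2 * ∑[ u < N ] degree G u + ∑[ u < N ] sent u
      ∎)
    where open ≤-Reasoning

module RotationCounts {N} {G : SimpleGraph N} (R : RotationSystem G) where
  open RotationSystem R

  rev-involutive : ∀ d → rev (rev d) ≡ d
  rev-involutive d = dart-inj _ _ (trans (rev-tail (rev d)) (rev-head d)) (trans (rev-head (rev d)) (rev-tail d))

  darts≤2E : darts ≤ 2 * E
  darts≤2E = Orbits.orbits-involution rev rev-involutive

  V≤N : V ≤ N
  V≤N = subst (_≤ N) (sym (Orbits.orbits≡∑ rot)) (∑-injective (Orbits.isOrbitMin rot) tail same-vertex)
    where
    same-vertex : ∀ {d e} → Orbits.isOrbitMin rot d ≡ true → Orbits.isOrbitMin rot e ≡ true →
                  tail d ≡ tail e → d ≡ e
    same-vertex {d} {e} mind mine td≡te =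
      let j , rotʲd≡e = rot-cyclic d e td≡te in Orbits.isOrbitMin-unique rot rot-inj mind mine j rotʲd≡e

  ∑degree≤darts : ∑[ u < N ] degree G u ≤ darts
  ∑degree≤darts = subst (_≤ darts) (sum-cong-≗ (sym ∘ degree≡∑ G)) (∑∑-covered (adj G) tail head dart-surj)

  1≤K : 1 ≤ darts → 1 ≤ K
  1≤K = 1≤components rot rev

  φ : Fin darts → Fin darts
  φ d = rot (rev d)

  φ-injective : Injective _≡_ _≡_ φ
  φ-injective {d} {e} φd≡φe =
    trans (sym (rev-involutive d)) (trans (cong rev (rot-inj φd≡φe)) (rev-involutive e))

  tail-φ : ∀ d → tail (φ d) ≡ head d
  tail-φ d = trans (rot-tail (rev d)) (rev-tail d)

  face-step : ∀ d → Adjacent G (tail d) (tail (φ d))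
  face-step d = subst (Adjacent G (tail d)) (sym (tail-φ d)) (dart-adj d)

  module _ (δ≥2 : ∀ x → 2 ≤ degree G x) where

    -- Otherwise rot fixes rev d, so rev d is the only dart at head d.
    face-nonbacktracking : ∀ d → tail d ≢ tail (φ (φ d))
    face-nonbacktracking d td≡tφφd = <⇒≱ (δ≥2 (head d)) (degree≤1 G (tail d) only-tail-d)
      where
      φd≡revd : φ d ≡ rev d
      φd≡revd = dart-inj _ _ (trans (tail-φ d) (sym (rev-tail d)))
                             (trans (sym (trans td≡tφφd (tail-φ (φ d)))) (sym (rev-head d)))
      only-tail-d : ∀ w → Adjacent G (head d) w → w ≡ tail d
      only-tail-d w hd~w =
        let e , te≡hd , he≡w = dart-surj (head d) w hd~w
            j , rotʲ≡e = rot-cyclic (rev d) e (trans (rev-tail d) (sym te≡hd))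
        in trans (sym he≡w) (trans (cong head (trans (sym rotʲ≡e) (iter-fixed φd≡revd j))) (rev-head d))

    faceWalk : ∀ z ℓ → iter ℓ φ z ≡ z → NonBacktrackingClosedWalk G ℓ
    faceWalk z ℓ φˡz≡z = record
      { pos             = λ t → tail (iter t φ z)
      ; periodic        = λ t → cong tail (trans (iter-+ t ℓ φ z) (cong (iter t φ) φˡz≡z))
      ; step            = λ t → face-step (iter t φ z)
      ; nonbacktracking = λ t → face-nonbacktracking (iter t φ z)
      }

    6F≤darts : GirthAtLeast G 6 → 6 * F ≤ darts
    6F≤darts girth≥6 = Orbits.orbits-aperiodic φ φ-injective 6 λ z i 1≤i i<6 φⁱz≡z →
      girth≥6⇒¬shortClosedWalk girth≥6 1≤i i<6 (faceWalk z i φⁱz≡z)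

euler-excess : ∀ {V F E K D} → 6 * V ≤ 2 * D → 6 * F ≤ D → D ≤ 2 * E → 1 ≤ K → V + F ≢ E + 2 * K
euler-excess {V} {F} {E} {K} {D} 6V≤2D 6F≤D D≤2E 1≤K euler = m+1+n≰m (6 * E) (begin
  6 * E + 12          ≤⟨ +-monoʳ-≤ (6 * E) (*-monoʳ-≤ 12 1≤K) ⟩
  6 * E + 12 * K      ≡⟨ cong (6 * E +_) (*-assoc 6 2 K) ⟩
  6 * E + 6 * (2 * K) ≡⟨ *-distribˡ-+ 6 E (2 * K) ⟨
  6 * (E + 2 * K)     ≡⟨ cong (6 *_) euler ⟨
  6 * (V + F)         ≡⟨ *-distribˡ-+ 6 V F ⟩
  6 * V + 6 * F       ≤⟨ +-mono-≤ 6V≤2D 6F≤D ⟩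
  2 * D + D           ≡⟨ +-comm (2 * D) D ⟩
  3 * D               ≤⟨ *-monoʳ-≤ 3 D≤2E ⟩
  3 * (2 * E)         ≡⟨ *-assoc 3 2 E ⟨
  6 * E               ∎)
  where open ≤-Reasoning

no-configuration⇒¬euler : ∀ {n} (G : SimpleGraph (suc n)) (R : RotationSystem G) → GirthAtLeast G 6 →
                          ¬ LowVertex G → ¬ Light2Vertex G → ¬ Full5Vertex G →
                          RotationSystem.V R + RotationSystem.F R ≢ RotationSystem.E R + 2 * RotationSystem.K R
no-configuration⇒¬euler {n} G R girth≥6 ¬low ¬light ¬full =
  euler-excess {V} {F} {E} {K} 6V≤2darts (6F≤darts δ≥2 girth≥6) darts≤2E (1≤K 1≤darts)
  where
  open RotationSystem R
  open RotationCounts R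
  open Discharging G ¬low ¬light ¬full

  6N≤2darts : 6 * suc n ≤ 2 * darts
  6N≤2darts = ≤-trans 6N≤2∑degree (*-monoʳ-≤ 2 ∑degree≤darts)

  6V≤2darts : 6 * V ≤ 2 * darts
  6V≤2darts = ≤-trans (*-monoʳ-≤ 6 V≤N) 6N≤2darts

  1≤darts : 1 ≤ darts
  1≤darts = n≢0⇒n>0 λ darts≡0 → contradiction (subst (λ D → 6 * suc n ≤ 2 * D) darts≡0 6N≤2darts) λ ()

corollary3p7 : ∀ (n : ℕ) (G : SimpleGraph (suc n)) → Planar G → GirthAtLeast G 6 →
    (∃ λ x → degree G x ≤ 1)
    ⊎ (∃₂ λ x y → degree G x ≡ 2 × Adjacent G x y × degree G y ≤ 4)
    ⊎ (∃ λ x → degree G x ≡ 5 × (∀ y → Adjacent G x y → degree G y ≡ 2))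
corollary3p7 n G (R , euler) girth≥6 with lowVertex? G | light2Vertex? G | full5Vertex? G
... | yes low | _         | _        = inj₁ low
... | no _    | yes light | _        = inj₂ (inj₁ light)
... | no _    | no _      | yes full = inj₂ (inj₂ full)
... | no ¬low | no ¬light | no ¬full = contradiction euler (no-configuration⇒¬euler G R girth≥6 ¬low ¬light ¬full)
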